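{- Let $\mathcal{L}\in\{\mathrm{PL},\mathrm{PL}(\underline{\vee}),\mathrm{PD}\}$ and let $\varphi$ be an $\mathcal{L}$-formula. Every tableau for $\varphi$ in $\mathbf{T}_{\mathcal{L}}$ is finite.
   Context: Syntax (negation normal form) over proposition symbols: $\mathrm{PL}$: $\varphi::=p\mid\neg p\mid(\varphi\wedge\varphi)\mid(\varphi\vee\varphi)$; $\mathrm{PL}(\underline{\vee})$ adds intuitionistic disjunction $(\varphi\,\underline{\vee}\,\varphi)$; $\mathrm{PD}$ adds dependence atoms ${=}(p_1,\dots,p_n,q)$, $n\ge0$. For a proposition symbol $p$, $p^\top:=p$, $p^\bot:=\neg p$. $\mathrm{vrank}(\varphi)$ is the number of occurrences of $\underline{\vee}$ in $\varphi$, where for $\mathrm{PD}$ formulas each atom ${=}(p_1,\dots,p_n,q)$ is first replaced by $\bigvee_{\vec a\in\{\bot,\top\}^n}\bigwedge\{p_1^{a_1},\dots,p_n^{a_n},(q\,\underline{\vee}\,\neg q)\}$ (so contributes $2^n$); for $\mathrm{PL}$ formulas $\mathrm{vrank}=0$. Labeled tableaux: a label is a finite subset of $\mathbb{N}$; a labeled formula is $\alpha:\varphi$ (intended: the team named $\alpha$ falsifies $\varphi$). A tableau is a finitely branching tree whose nodes are labeled formulas, built from the root by rule applications: a rule whose premise lies on a branch extends that branch by the listed alternatives (separated by $\mid$), each alternative adding all its listed labeled formulas. A labeled formula is never added to a branch in which it already occurs. Rules: (Prop) from $\{i_1,\dots,i_k\}:p$: $\{i_1\}:p\mid\dots\mid\{i_k\}:p$.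 ($\neg$Prop) likewise for $\neg p$. ($\wedge$) from $\alpha:(\varphi\wedge\psi)$: $\alpha:\varphi\mid\alpha:\psi$. ($\vee$) from $\alpha:(\varphi\vee\psi)$, for any $\beta\subseteq\alpha$: $\beta:\varphi\mid\alpha\setminus\beta:\psi$. ($\underline{\vee}$) from $\alpha:(\varphi\,\underline{\vee}\,\psi)$: add both $\alpha:\varphi$ and $\alpha:\psi$ (one branch). (Split) from $\alpha:{=}(p_1,\dots,p_n,q)$: $\alpha_1:{=}(\vec p,q)\mid\dots\mid\alpha_k:{=}(\vec p,q)$ where $\alpha_1,\dots,\alpha_k$ are exactly all subsets of $\alpha$ of cardinality 2. (PL dep) from $\{i_1,i_2\}:{=}(p_1,\dots,p_n,q)$: one alternative for each function $g:\{1,\dots,n\}\to\{\top,\bot\}$, adding $\{i_1\}:p_m^{g(m)}$ and $\{i_2\}:p_m^{g(m)}$ for $m=1,\dots,n$, together with $\{i_1,i_2\}:q$ and $\{i_1,i_2\}:\neg q$. Calculi: $\mathbf{T}_{\mathrm{PL}}$ = (Prop), ($\neg$Prop), ($\wedge$), ($\vee$); $\mathbf{T}_{\mathrm{PL}(\underline{\vee})}$ = $\mathbf{T}_{\mathrm{PL}}$ + ($\underline{\vee}$); $\mathbf{T}_{\mathrm{PD}}$ = $\mathbf{T}_{\mathrm{PL}}$ + (Split) + (PL dep). A tableau for $\varphi$ in $\mathbf{T}_{\mathcal{L}}$ is one with root $\{1,\dots,2^{\mathrm{vrank}(\varphi)}\}:\varphi$ obtained by applying rules of $\mathbf{T}_{\mathcal{L}}$.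 -}

module Defs where

open import Data.Nat using (ℕ; zero; suc; _+_; _^_; _<_)
open import Data.Bool using (Bool; true; false; not)
open import Data.List using (List; []; _∷_; map; _++_; concatMap; length; upTo)
open import Data.List.Membership.Propositional using (_∈_)
open import Data.Product using (_×_; _,_)
open import Relation.Binary.PropositionalEquality using (_≡_; _≢_)
open import Relation.Nullary using (¬_)

infixr 6 _∧'_
infixr 5 _∨'_ _⩒_

data Form : Set where
  pos  : ℕ → Form
  neg  : ℕ → Form
  _∧'_ : Form → Form → Form
  _∨'_ : Form → Form → Form       -- (tensor / split) disjunction ∨
  _⩒_  : Form → Form → Form       -- intuitionistic disjunction (underlined ∨)
  dep  : List ℕ → ℕ → Form

data Lang : Set where
  PL PLv PD : Lang

data IsFormula : Lang → Form → Set where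
  f-pos : ∀ {L p} → IsFormula L (pos p)
  f-neg : ∀ {L p} → IsFormula L (neg p)
  f-∧   : ∀ {L φ ψ} → IsFormula L φ → IsFormula L ψ → IsFormula L (φ ∧' ψ)
  f-∨   : ∀ {L φ ψ} → IsFormula L φ → IsFormula L ψ → IsFormula L (φ ∨' ψ)
  f-⩒   : ∀ {φ ψ} → IsFormula PLv φ → IsFormula PLv ψ → IsFormula PLv (φ ⩒ ψ)
  f-dep : ∀ {ps q} → IsFormula PD (dep ps q)

vrank : Form → ℕ
vrank (pos _)   = 0
vrank (neg _)   = 0
vrank (φ ∧' ψ)  = vrank φ + vrank ψ
vrank (φ ∨' ψ)  = vrank φ + vrank ψ
vrank (φ ⩒ ψ)   = suc (vrank φ + vrank ψ)
vrank (dep ps q) = 2 ^ length ps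

-- A label (finite subset of ℕ) is represented by a list of naturals.
-- All labels arising in a tableau are order-preserving duplicate-free
-- sublists of the root label [1,…,2^vrank], so list equality coincides
-- with set equality on them.

Label : Set
Label = List ℕ

LForm : Set
LForm = Label × Form

range1 : ℕ → Label
range1 n = map suc (upTo n)

select : (ℕ → Bool) → Label → Label
select f [] = []
select f (i ∷ α) with f i
... | true  = i ∷ select f α
... | false = select f α

pairs : Label → List (ℕ × ℕ)
pairs [] = []
pairs (i ∷ α) = map (λ j → (i , j)) α ++ pairs α

-- all functions {1,…,n} → {⊤,⊥}, as lists of length n (true = ⊤)
allFuns : ℕ → List (List Bool)
allFuns zero = [] ∷ []
allFuns (suc n) = map (true ∷_) (allFuns n) ++ map (false ∷_) (allFuns n)

lit : ℕ → Bool → Form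
lit p true  = pos p
lit p false = neg p

depLits : ℕ → ℕ → List ℕ → List Bool → List LForm
depLits i₁ i₂ (p ∷ ps) (b ∷ g) =
  ((i₁ ∷ []) , lit p b) ∷ ((i₂ ∷ []) , lit p b) ∷ depLits i₁ i₂ ps g
depLits i₁ i₂ _ _ = []

-- Rules: Rule L prem alts  means that some rule of T_L has premise
-- prem and yields the alternatives alts (each alternative a list of
-- labeled formulas to be added together).

data Rule : Lang → LForm → List (List LForm) → Set where
  r-prop : ∀ {L α p} →
    Rule L (α , pos p) (map (λ i → ((i ∷ []) , pos p) ∷ []) α)
  r-negprop : ∀ {L α p} →
    Rule L (α , neg p) (map (λ i → ((i ∷ []) , neg p) ∷ []) α)
  r-∧ : ∀ {L α φ ψ} →
    Rule L (α , φ ∧' ψ) (((α , φ) ∷ []) ∷ ((α , ψ) ∷ []) ∷ [])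
  r-∨ : ∀ {L α φ ψ} (β : ℕ → Bool) →
    Rule L (α , φ ∨' ψ)
      (((select β α , φ) ∷ []) ∷ ((select (λ i → not (β i)) α , ψ) ∷ []) ∷ [])
  r-⩒ : ∀ {α φ ψ} →
    Rule PLv (α , φ ⩒ ψ) (((α , φ) ∷ (α , ψ) ∷ []) ∷ [])
  r-split : ∀ {α ps q} →
    Rule PD (α , dep ps q)
      (map (λ { (i , j) → ((i ∷ j ∷ []) , dep ps q) ∷ [] }) (pairs α))
  r-pldep : ∀ {i₁ i₂ ps q} → i₁ ≢ i₂ →
    Rule PD ((i₁ ∷ i₂ ∷ []) , dep ps q)
      (map (λ g → depLits i₁ i₂ ps g ++
                  ((i₁ ∷ i₂ ∷ []) , pos q) ∷ ((i₁ ∷ i₂ ∷ []) , neg q) ∷ [])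
           (allFuns (length ps)))

-- Adding an alternative to a branch: formulas already on the branch
-- (including those just added) are skipped.
-- Fresh b xs ys : adding xs to branch b actually adds ys.

data Fresh : List LForm → List LForm → List LForm → Set where
  fr-[]   : ∀ {b} → Fresh b [] []
  fr-skip : ∀ {b x xs ys} → x ∈ b → Fresh b xs ys → Fresh b (x ∷ xs) ys
  fr-keep : ∀ {b x xs ys} → ¬ (x ∈ b) → Fresh (x ∷ b) xs ys →
            Fresh b (x ∷ xs) (x ∷ ys)

data FreshAll (b : List LForm) : List (List LForm) → List (List LForm) → Set where
  fa-[] : FreshAll b [] []
  fa-∷  : ∀ {xs ys xss yss} → Fresh b xs ys → FreshAll b xss yss →
          FreshAll b (xs ∷ xss) (ys ∷ yss)

data Tree : Set where
  node : LForm → List Tree → Tree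

chain : LForm → List LForm → Tree
chain x [] = node x []
chain x (y ∷ ys) = node x (chain y ys ∷ [])

chains : List (List LForm) → List Tree
chains [] = []
chains ([] ∷ yss) = chains yss
chains ((y ∷ ys) ∷ yss) = chain y ys ∷ chains yss

-- Step L b t t' : t' arises from t by one rule application of T_L
-- that adds at least one new node; b is the list of labeled formulas on
-- the path from the root down to (excluding) the root of t.
mutual
  data Step (L : Lang) (b : List LForm) : Tree → Tree → Set where
    st-leaf : ∀ {x prem alts news} →
      prem ∈ (x ∷ b) →
      Rule L prem alts →
      FreshAll (x ∷ b) alts news →
      chains news ≢ [] →
      Step L b (node x []) (node x (chains news))
    st-node : ∀ {x ts ts'} →
      StepList L (x ∷ b) ts ts' →
      Step L b (node x ts) (node x ts')

  data StepList (L : Lang) (b : List LForm) : List Tree → List Tree → Set where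
    sl-here  : ∀ {t t' ts} → Step L b t t' → StepList L b (t ∷ ts) (t' ∷ ts)
    sl-there : ∀ {t ts ts'} → StepList L b ts ts' → StepList L b (t ∷ ts) (t ∷ ts')

rootTableau : Form → Tree
rootTableau φ = node (range1 (2 ^ vrank φ) , φ) []

Extends : Lang → Tree → Tree → Set
Extends L t' t = Step L [] t t'

-- A rule application only adds labeled formulas whose label is a sublist
-- of the premise's label and whose formula lies in the (finite) closure
-- of the premise's formula.  Hence every node of a tableau for φ belongs
-- to the finite set  sublists(root label) × closure(φ).  Since a rule
-- never adds a formula already on the branch, branches are repetition
-- free, so their length is bounded by the size of that set; a finitely
-- branching tree of bounded depth admits only finitely many extensions.
module Submission where

open import Defs
open import Induction.WellFounded using (Acc; acc)
open import Data.Nat using (ℕ; suc; _+_; _≤_; _<_; _∸_; _^_; z≤n; s≤s)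
open import Data.Nat.Properties using (≤-refl; ∸-monoʳ-<; +-suc)
open import Data.Nat.Induction using (<-wellFounded)
open import Data.Bool using (true; false; not)
open import Data.List using (List; []; _∷_; map; _++_; length; cartesianProduct)
open import Data.List.Properties using (length-++)
open import Data.List.Membership.Propositional using (_∈_; _∉_)
open import Data.List.Membership.Propositional.Properties
  using (∈-∃++; ∈-++⁺ˡ; ∈-++⁺ʳ; ∈-++⁻; ∈-map⁺; ∈-map⁻; ∈-cartesianProduct⁺)
open import Data.List.Relation.Binary.Subset.Propositional using (_⊆_)
open import Data.List.Relation.Binary.Subset.Propositional.Properties
  using (xs⊆xs++ys; xs⊆ys++xs)
open import Data.List.Relation.Binary.Sublist.Propositional
  using (_∷ʳ_; from∈; ⊆-refl; ⊆-trans) renaming (_⊆_ to _⊑_)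
import Data.List.Relation.Binary.Sublist.Propositional as Sublist
open import Data.List.Relation.Unary.Any using (here; there)
open import Data.List.Relation.Unary.All as All using (All; []; _∷_)
open import Data.List.Relation.Unary.All.Properties using (map⁺; ++⁺; ¬Any⇒All¬)
open import Data.List.Relation.Unary.Unique.Propositional using (Unique)
import Data.List.Relation.Unary.AllPairs as AllPairs
open import Data.Product using (_×_; _,_)
open import Data.Sum using (inj₁; inj₂)
open import Data.Empty using (⊥-elim)
open import Function using (_∘_; id)
open import Relation.Binary.PropositionalEquality using (_≢_; refl; cong)

unique-⊆⇒|xs|≤|ys| : ∀ {A : Set} {xs ys : List A} →
  Unique xs → xs ⊆ ys → length xs ≤ length ys
unique-⊆⇒|xs|≤|ys| {xs = []} _ _ = z≤n
unique-⊆⇒|xs|≤|ys| {xs = x ∷ xs} (x≢xs AllPairs.∷ u) xs⊆ys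
  with ys₁ , ys₂ , refl ← ∈-∃++ (xs⊆ys (here refl)) = begin
    suc (length xs)                ≤⟨ s≤s (unique-⊆⇒|xs|≤|ys| u xs⊆ys₁++ys₂) ⟩
    suc (length (ys₁ ++ ys₂))      ≡⟨ cong suc (length-++ ys₁) ⟩
    suc (length ys₁ + length ys₂)  ≡⟨ +-suc (length ys₁) (length ys₂) ⟨
    length ys₁ + length (x ∷ ys₂)  ≡⟨ length-++ ys₁ ⟨
    length (ys₁ ++ x ∷ ys₂)        ∎
  where
  open Data.Nat.Properties.≤-Reasoning
  xs⊆ys₁++ys₂ : xs ⊆ ys₁ ++ ys₂
  xs⊆ys₁++ys₂ {y} y∈xs with ∈-++⁻ ys₁ (xs⊆ys (there y∈xs))
  ... | inj₁ y∈ys₁         = ∈-++⁺ˡ y∈ys₁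
  ... | inj₂ (here refl)   = ⊥-elim (All.lookup x≢xs y∈xs refl)
  ... | inj₂ (there y∈ys₂) = ∈-++⁺ʳ ys₁ y∈ys₂

sublists : ∀ {A : Set} → List A → List (List A)
sublists []       = [] ∷ []
sublists (x ∷ xs) = map (x ∷_) (sublists xs) ++ sublists xs

⊑⇒∈sublists : ∀ {A : Set} {xs ys : List A} → xs ⊑ ys → xs ∈ sublists ys
⊑⇒∈sublists Sublist.[]           = here refl
⊑⇒∈sublists (_∷ʳ_ {ys = ys} y τ) = ∈-++⁺ʳ (map (y ∷_) (sublists ys)) (⊑⇒∈sublists τ)
⊑⇒∈sublists (refl Sublist.∷ τ)   = ∈-++⁺ˡ (∈-map⁺ _ (⊑⇒∈sublists τ))

select-⊑ : ∀ f α → select f α ⊑ α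
select-⊑ f []      = Sublist.[]
select-⊑ f (i ∷ α) with f i
... | true  = refl Sublist.∷ select-⊑ f α
... | false = i ∷ʳ select-⊑ f α

pairs-⊑ : ∀ α {i j} → (i , j) ∈ pairs α → i ∷ j ∷ [] ⊑ α
pairs-⊑ (k ∷ α) m with ∈-++⁻ (map (k ,_) α) m
... | inj₁ m′ with _ , j∈α , refl ← ∈-map⁻ (k ,_) m′ = refl Sublist.∷ from∈ j∈α
... | inj₂ m′ = k ∷ʳ pairs-⊑ α m′

lits : List ℕ → List Form
lits []       = []
lits (p ∷ ps) = pos p ∷ neg p ∷ lits ps

lit∈lits : ∀ {p ps} b → p ∈ ps → lit p b ∈ lits ps
lit∈lits true  (here refl) = here refl
lit∈lits false (here refl) = there (here refl)
lit∈lits b     (there p∈)  = there (there (lit∈lits b p∈))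

-- Includes the literals p, ¬p, q, ¬q that (PL dep) introduces from =(p⃗,q).
cl : Form → List Form
cl (pos p)    = pos p ∷ []
cl (neg p)    = neg p ∷ []
cl (φ ∧' ψ)   = (φ ∧' ψ) ∷ cl φ ++ cl ψ
cl (φ ∨' ψ)   = (φ ∨' ψ) ∷ cl φ ++ cl ψ
cl (φ ⩒ ψ)    = (φ ⩒ ψ) ∷ cl φ ++ cl ψ
cl (dep ps q) = dep ps q ∷ lits (q ∷ ps)

∈-cl-self : ∀ φ → φ ∈ cl φ
∈-cl-self (pos _)   = here refl
∈-cl-self (neg _)   = here refl
∈-cl-self (_ ∧' _)  = here refl
∈-cl-self (_ ∨' _)  = here refl
∈-cl-self (_ ⩒ _)   = here refl
∈-cl-self (dep _ _) = here refl

left∈cl : ∀ {χ} φ ψ → φ ∈ χ ∷ cl φ ++ cl ψ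
left∈cl φ ψ = there (∈-++⁺ˡ (∈-cl-self φ))

right∈cl : ∀ {χ} φ ψ → ψ ∈ χ ∷ cl φ ++ cl ψ
right∈cl φ ψ = there (∈-++⁺ʳ (cl φ) (∈-cl-self ψ))

ClosedUnderCl : List Form → Set
ClosedUnderCl Γ = ∀ {ψ} → ψ ∈ Γ → cl ψ ⊆ Γ

++-closedUnderCl : ∀ {Γ Δ} → ClosedUnderCl Γ → ClosedUnderCl Δ → ClosedUnderCl (Γ ++ Δ)
++-closedUnderCl {Γ} {Δ} closedΓ closedΔ ψ∈ with ∈-++⁻ Γ ψ∈
... | inj₁ ψ∈Γ = xs⊆xs++ys Γ Δ ∘ closedΓ ψ∈Γ
... | inj₂ ψ∈Δ = xs⊆ys++xs Δ Γ ∘ closedΔ ψ∈Δ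

lits-closedUnderCl : ∀ ps → ClosedUnderCl (lits ps)
lits-closedUnderCl (p ∷ ps) (here refl)         (here refl) = here refl
lits-closedUnderCl (p ∷ ps) (there (here refl)) (here refl) = there (here refl)
lits-closedUnderCl (p ∷ ps) (there (there ψ∈))  χ∈          =
  there (there (lits-closedUnderCl ps ψ∈ χ∈))

cl-closedUnderCl : ∀ φ → ClosedUnderCl (cl φ)
cl-closedUnderCl (pos _)    (here refl) = id
cl-closedUnderCl (neg _)    (here refl) = id
cl-closedUnderCl (φ ∧' ψ)   (here refl) = id
cl-closedUnderCl (φ ∧' ψ)   (there ψ∈)  =
  there ∘ ++-closedUnderCl (cl-closedUnderCl φ) (cl-closedUnderCl ψ) ψ∈
cl-closedUnderCl (φ ∨' ψ)   (here refl) = id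
cl-closedUnderCl (φ ∨' ψ)   (there ψ∈)  =
  there ∘ ++-closedUnderCl (cl-closedUnderCl φ) (cl-closedUnderCl ψ) ψ∈
cl-closedUnderCl (φ ⩒ ψ)    (here refl) = id
cl-closedUnderCl (φ ⩒ ψ)    (there ψ∈)  =
  there ∘ ++-closedUnderCl (cl-closedUnderCl φ) (cl-closedUnderCl ψ) ψ∈
cl-closedUnderCl (dep ps q) (here refl) = id
cl-closedUnderCl (dep ps q) (there ψ∈)  = there ∘ lits-closedUnderCl (q ∷ ps) ψ∈

_≼_ : LForm → LForm → Set
(β , χ) ≼ (α , ψ) = β ⊑ α × χ ∈ cl ψ

≼-refl : ∀ {x} → x ≼ x
≼-refl {_ , φ} = ⊆-refl , ∈-cl-self φ

≼-trans : ∀ {x y z} → x ≼ y → y ≼ z → x ≼ z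
≼-trans {_ , _} {_ , _} {_ , φ} (β⊑α , χ∈) (α⊑γ , ψ∈) =
  ⊆-trans β⊑α α⊑γ , cl-closedUnderCl φ ψ∈ χ∈

depLits⁺ : ∀ {P : LForm → Set} {i₁ i₂} ps g →
  (∀ {p} b → p ∈ ps → P ((i₁ ∷ []) , lit p b)) →
  (∀ {p} b → p ∈ ps → P ((i₂ ∷ []) , lit p b)) →
  All P (depLits i₁ i₂ ps g)
depLits⁺ []       _       _  _  = []
depLits⁺ (_ ∷ _)  []      _  _  = []
depLits⁺ (p ∷ ps) (b ∷ g) P₁ P₂ =
  P₁ b (here refl) ∷ P₂ b (here refl) ∷ depLits⁺ ps g (λ b → P₁ b ∘ there) (λ b → P₂ b ∘ there)

rule-conclusions-≼ : ∀ {L prem alts} → Rule L prem alts → All (All (_≼ prem)) alts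
rule-conclusions-≼ r-prop    = map⁺ (All.tabulate λ i∈ → (from∈ i∈ , here refl) ∷ [])
rule-conclusions-≼ r-negprop = map⁺ (All.tabulate λ i∈ → (from∈ i∈ , here refl) ∷ [])
rule-conclusions-≼ (r-∧ {φ = φ} {ψ}) =
  ((⊆-refl , left∈cl φ ψ) ∷ []) ∷ ((⊆-refl , right∈cl φ ψ) ∷ []) ∷ []
rule-conclusions-≼ (r-∨ {α = α} {φ} {ψ} β) =
  ((select-⊑ β α , left∈cl φ ψ) ∷ []) ∷ ((select-⊑ (not ∘ β) α , right∈cl φ ψ) ∷ []) ∷ []
rule-conclusions-≼ (r-⩒ {φ = φ} {ψ}) =
  ((⊆-refl , left∈cl φ ψ) ∷ (⊆-refl , right∈cl φ ψ) ∷ []) ∷ []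
rule-conclusions-≼ (r-split {α = α}) =
  map⁺ (All.tabulate λ { {_ , _} m → (pairs-⊑ α m , here refl) ∷ [] })
rule-conclusions-≼ (r-pldep {ps = ps} _) = map⁺ (All.tabulate λ {g} _ →
  ++⁺ (depLits⁺ ps g (λ b p∈ → (from∈ (here refl) , literal b p∈))
                     (λ b p∈ → (from∈ (there (here refl)) , literal b p∈)))
      ((⊆-refl , there (here refl)) ∷ (⊆-refl , there (there (here refl))) ∷ []))
  where
  literal : ∀ {p q} b → p ∈ ps → lit p b ∈ cl (dep ps q)
  literal b p∈ = there (there (there (lit∈lits b p∈)))

rule-preserves-≼ : ∀ {L prem alts z} → Rule L prem alts → prem ≼ z → All (All (_≼ z)) alts
rule-preserves-≼ r prem≼z =
  All.map (All.map (λ x≼prem → ≼-trans x≼prem prem≼z)) (rule-conclusions-≼ r)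

module _ (L : Lang) where

  Grows : List LForm → Tree → Tree → Set
  Grows b t′ t = Step L b t t′

  GrowsList : List LForm → List Tree → List Tree → Set
  GrowsList b ts′ ts = StepList L b ts ts′

  acc-∷ : ∀ {b t ts} → Acc (Grows b) t → Acc (GrowsList b) ts → Acc (GrowsList b) (t ∷ ts)
  acc-∷ acc-t@(acc rec-t) acc-ts@(acc rec-ts) = acc λ
    { (sl-here s)  → acc-∷ (rec-t s) acc-ts
    ; (sl-there s) → acc-∷ acc-t (rec-ts s) }

  acc-All : ∀ {b ts} → All (Acc (Grows b)) ts → Acc (GrowsList b) ts
  acc-All []       = acc λ ()
  acc-All (a ∷ as) = acc-∷ a (acc-All as)

  acc-node : ∀ {b x ts} → ts ≢ [] → All (Acc (Grows (x ∷ b))) ts → Acc (Grows b) (node x ts)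
  acc-node {ts = []}    ts≢[] _      = ⊥-elim (ts≢[] refl)
  acc-node {ts = _ ∷ _} _     acc-ts = inner (acc-All acc-ts)
    where
    inner : ∀ {b x t ts} → Acc (GrowsList (x ∷ b)) (t ∷ ts) → Acc (Grows b) (node x (t ∷ ts))
    inner (acc rec) = acc λ
      { (st-node (sl-here s))  → inner (rec (sl-here s))
      ; (st-node (sl-there s)) → inner (rec (sl-there s)) }

module FiniteUniverse
  (L : Lang) (P : LForm → Set) (U : List LForm) (P⇒∈U : ∀ {x} → P x → x ∈ U)
  (rule-preserves-P : ∀ {prem alts} → Rule L prem alts → P prem → All (All P) alts)
  where

  data Irredundant (b : List LForm) : Tree → Set where
    irredundant : ∀ {x ts} → P x → x ∉ b → All (Irredundant (x ∷ b)) ts →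
                  Irredundant b (node x ts)

  fresh-chain : ∀ {b xs y ys} → Fresh b xs (y ∷ ys) → All P xs → Irredundant b (chain y ys)
  fresh-chain (fr-skip _ f)                  (_  ∷ Pxs) = fresh-chain f Pxs
  fresh-chain (fr-keep {ys = []}    x∉b _)   (Px ∷ _)   = irredundant Px x∉b []
  fresh-chain (fr-keep {ys = _ ∷ _} x∉b f)   (Px ∷ Pxs) =
    irredundant Px x∉b (fresh-chain f Pxs ∷ [])

  fresh-chains : ∀ {b alts news} → FreshAll b alts news → All (All P) alts →
                 All (Irredundant b) (chains news)
  fresh-chains fa-[]                     []           = []
  fresh-chains (fa-∷ {ys = []}    _ fa)  (_   ∷ Palts) = fresh-chains fa Palts
  fresh-chains (fa-∷ {ys = _ ∷ _} f fa)  (Pxs ∷ Palts) =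
    fresh-chain f Pxs ∷ fresh-chains fa Palts

  slack : List LForm → ℕ
  slack b = length U ∸ length b

  slack-∷ : ∀ {x b} → Unique (x ∷ b) → All P (x ∷ b) → slack (x ∷ b) < slack b
  slack-∷ u Pxb = ∸-monoʳ-< ≤-refl (unique-⊆⇒|xs|≤|ys| u (P⇒∈U ∘ All.lookup Pxb))

  acc-irredundant : ∀ {b t} → Acc _<_ (slack b) → Unique b → All P b → Irredundant b t →
                    Acc (Grows L b) t
  acc-irredundant {b} (acc rec) ub Pb (irredundant {x} {ts} Px x∉b irr-ts) =
    acc-children ts irr-ts
    where
    uxb : Unique (x ∷ b)
    uxb = ¬Any⇒All¬ b x∉b AllPairs.∷ ub

    acc-below : ∀ {us} → All (Irredundant (x ∷ b)) us → All (Acc (Grows L (x ∷ b))) us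
    acc-below = All.map (acc-irredundant (rec (slack-∷ uxb (Px ∷ Pb))) uxb (Px ∷ Pb))

    acc-children : ∀ us → All (Irredundant (x ∷ b)) us → Acc (Grows L b) (node x us)
    acc-children (u ∷ us) irr = acc-node L (λ ()) (acc-below irr)
    acc-children []       _   = acc λ
      { (st-leaf prem∈ r fa adds) →
          acc-node L adds
            (acc-below (fresh-chains fa (rule-preserves-P r (All.lookup (Px ∷ Pb) prem∈)))) }

  acc-leaf : ∀ {x} → P x → Acc (Extends L) (node x [])
  acc-leaf Px = acc-irredundant (<-wellFounded _) AllPairs.[] [] (irredundant Px (λ ()) [])

rootLabel : Form → Label
rootLabel φ = range1 (2 ^ vrank φ)

universe : Form → List LForm
universe φ = cartesianProduct (sublists (rootLabel φ)) (cl φ)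

≼root⇒∈universe : ∀ {φ x} → x ≼ (rootLabel φ , φ) → x ∈ universe φ
≼root⇒∈universe (α⊑root , ψ∈) = ∈-cartesianProduct⁺ (⊑⇒∈sublists α⊑root) ψ∈

theorem4 : (L : Lang) (φ : Form) → IsFormula L φ →
    Acc (Extends L) (rootTableau φ)
theorem4 L φ _ = acc-leaf ≼-refl
  where
  open FiniteUniverse L (_≼ (rootLabel φ , φ)) (universe φ) ≼root⇒∈universe rule-preserves-≼
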